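{- Let $\mathcal M$ be an abstract hybrid data model, $\Sigma$ a closed set of formulas, and $\mathcal M^f$ a filtration of $\mathcal M$ via $\Sigma$. Then (1) for all $\varphi\in\Sigma$ and all states $m$ of $\mathcal M$: $\mathcal M^f,[m]\models\varphi$ iff $\mathcal M,m\models\varphi$; and (2) for all $\langle\alpha\rangle\top\in\Sigma$ and all states $m,n$ of $\mathcal M$: $\mathcal M^f,[m],[n]\models\alpha$ iff for all $m'\in[m]$ there exists $n'\in[n]$ such that $\mathcal M,m',n'\models\alpha$.
   Context: Language. Countable $\mathsf{Prop}$, countable $\mathsf{Nom}$ disjoint from it, sets $\mathsf{Mod}$, $\mathsf{Eq}$. Path expressions $\alpha::=\mathsf a\mid @_i\mid[\varphi]\mid\alpha\beta\mid\alpha\cup\beta$ (union taken as primitive); node expressions $\varphi::=p\mid i\mid\neg\varphi\mid\varphi\wedge\psi\mid\langle\alpha=_e\beta\rangle\mid\langle\alpha\neq_e\beta\rangle$; $*$ is $=_e$ or $\neq_e$. Abbreviations: usual Booleans; $\top:=p\vee\neg p$; $\langle\alpha\rangle\varphi:=\langle\alpha[\varphi]=_e\alpha[\varphi]\rangle$; $@_i\varphi:=\langle @_i\rangle\varphi$. Models $\mathcal M=\langle M,\{\sim_e\},\{R_{\mathsf a}\},V,\mathit{nom}\rangle$ ($\sim_e$ equivalence relations on $M\neq\emptyset$, $R_{\mathsf a}\subseteq M^2$, $V:M\to2^{\mathsf{Prop}}$, $\mathit{nom}:\mathsf{Nom}\to M$). Semantics: $m,n\models\mathsf a$ iff $mR_{\mathsf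 a}n$; $m,n\models@_i$ iff $\mathit{nom}(i)=n$; $m,n\models[\varphi]$ iff $m=n$ and $m\models\varphi$; $m,n\models\alpha\beta$ iff some $l$ with $m,l\models\alpha$, $l,n\models\beta$; $m,n\models\alpha\cup\beta$ iff $m,n\models\alpha$ or $m,n\models\beta$; $m\models p$ iff $p\in V(m)$; $m\models i$ iff $\mathit{nom}(i)=m$; Booleans usual; $m\models\langle\alpha=_e\beta\rangle$ (resp. $\neq_e$) iff there are $n,l$ with $m,n\models\alpha$, $m,l\models\beta$, $n\sim_el$ (resp. not). A set $\Sigma$ of formulas is closed if: $\neg\varphi\in\Sigma\Rightarrow\varphi\in\Sigma$; $\varphi\wedge\psi\in\Sigma\Rightarrow\varphi,\psi\in\Sigma$; $\langle\alpha*\beta\rangle\in\Sigma\Rightarrow\langle\alpha\rangle\top,\langle\beta\rangle\top\in\Sigma$; $\langle[\varphi]\rangle\top\in\Sigma\Rightarrow\varphi\in\Sigma$; $\langle @_i\rangle\top\in\Sigma\Rightarrow i\in\Sigma$; $\langle\alpha\beta\rangle\top\in\Sigma\Rightarrow\langle\alpha\rangle\top,\langle\beta\rangle\top\in\Sigma$; $\langle\alpha\cup\beta\rangle\top\in\Sigma\Rightarrow\langle\alpha\rangle\top,\langle\beta\rangle\top\in\Sigma$. For states $m,n$, $m\equiv_\Sigma n$ iff for all $\varphi\in\Sigma$, $\mathcal M,m\models\varphi\iff\mathcal M,n\models\varphi$; $[m]$ is the class of $m$. A filtration of $\mathcal M$ via $\Sigma$ is any $\mathcal M^f=\langle M^f,\{\sim^f_e\},\{R^f_{\mathsf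 a}\},V^f,\mathit{nom}^f\rangle$ with: $M^f=M/{\equiv_\Sigma}$; $mR_{\mathsf a}n$ implies $[m]R^f_{\mathsf a}[n]$; if $[m]R^f_{\mathsf a}[n]$ then, provided $\langle\mathsf a\rangle\top\in\Sigma$, for all $m'\in[m]$ there is $n'\in[n]$ with $m'R_{\mathsf a}n'$; $[m]\sim^f_e[n]$ iff $m\sim_en$; $\mathit{nom}^f(i)=[\mathit{nom}(i)]$; $V^f([m])=\{p\mid p\in V(m)\}$. -}

module Defs where

open import Data.Nat using (ℕ)
open import Data.Product using (Σ; _×_; ∃)
open import Data.Sum using (_⊎_)
open import Relation.Nullary using (¬_)
open import Relation.Binary.PropositionalEquality using (_≡_)
open import Relation.Binary.Structures using (IsEquivalence)
open import Function.Bundles using (_⇔_; _↣_)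

-- Signature: Prop, Nom (countable; disjointness is automatic since they
-- are used through distinct constructors), Mod, Eq.
-- p₀ is the fixed proposition letter used in ⊤ := p₀ ∨ ¬p₀ and e₀ the
-- fixed data-equality symbol used in the abbreviation ⟨α⟩φ.

record Signature : Set₁ where
  field
    Prop Nom Mod Eq : Set
    Prop-countable  : Prop ↣ ℕ
    Nom-countable   : Nom ↣ ℕ
    p₀              : Prop
    e₀              : Eq

module _ (S : Signature) where
  open Signature S

  mutual
    data Path : Set where
      act  : Mod → Path
      at   : Nom → Path
      test : Form → Path
      _⨾_  : Path → Path → Path
      _∪_  : Path → Path → Path

    data Form : Set where
      prop : Prop → Form
      nom  : Nom → Form
      ¬'_  : Form → Form
      _∧'_ : Form → Form → Form
      ⟨_=[_]_⟩ : Path → Eq → Path → Form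
      ⟨_≠[_]_⟩ : Path → Eq → Path → Form

  _∨'_ : Form → Form → Form
  φ ∨' ψ = ¬' ((¬' φ) ∧' (¬' ψ))

  ⊤' : Form
  ⊤' = prop p₀ ∨' (¬' prop p₀)

  ⟨_⟩_ : Path → Form → Form
  ⟨ α ⟩ φ = ⟨ α ⨾ test φ =[ e₀ ] α ⨾ test φ ⟩

  record Model : Set₁ where
    field
      Carrier : Set
      inhabited : Carrier
      _∼[_]_  : Carrier → Eq → Carrier → Set
      ∼-equiv : (e : Eq) → IsEquivalence (λ m n → m ∼[ e ] n)
      R       : Mod → Carrier → Carrier → Set
      V       : Carrier → Prop → Set
      nomM    : Nom → Carrier

  module _ (𝓜 : Model) where
    open Model 𝓜

    mutual
      _,_⊨ₚ_ : Carrier → Carrier → Path → Set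
      m , n ⊨ₚ act a = R a m n
      m , n ⊨ₚ at i = nomM i ≡ n
      m , n ⊨ₚ test φ = (m ≡ n) × (m ⊨ φ)
      m , n ⊨ₚ (α ⨾ β) = Σ Carrier (λ l → (m , l ⊨ₚ α) × (l , n ⊨ₚ β))
      m , n ⊨ₚ (α ∪ β) = (m , n ⊨ₚ α) ⊎ (m , n ⊨ₚ β)

      _⊨_ : Carrier → Form → Set
      m ⊨ prop p = V m p
      m ⊨ nom i = nomM i ≡ m
      m ⊨ (¬' φ) = ¬ (m ⊨ φ)
      m ⊨ (φ ∧' ψ) = (m ⊨ φ) × (m ⊨ ψ)
      m ⊨ ⟨ α =[ e ] β ⟩ =
        Σ Carrier (λ n → Σ Carrier (λ l → (m , n ⊨ₚ α) × (m , l ⊨ₚ β) × (n ∼[ e ] l)))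
      m ⊨ ⟨ α ≠[ e ] β ⟩ =
        Σ Carrier (λ n → Σ Carrier (λ l → (m , n ⊨ₚ α) × (m , l ⊨ₚ β) × ¬ (n ∼[ e ] l)))

  FormSet : Set₁
  FormSet = Form → Set

  record Closed (Γ : FormSet) : Set where
    field
      c-¬   : ∀ φ → Γ (¬' φ) → Γ φ
      c-∧ˡ  : ∀ φ ψ → Γ (φ ∧' ψ) → Γ φ
      c-∧ʳ  : ∀ φ ψ → Γ (φ ∧' ψ) → Γ ψ
      c-=ˡ  : ∀ α e β → Γ ⟨ α =[ e ] β ⟩ → Γ (⟨ α ⟩ ⊤')
      c-=ʳ  : ∀ α e β → Γ ⟨ α =[ e ] β ⟩ → Γ (⟨ β ⟩ ⊤')
      c-≠ˡ  : ∀ α e β → Γ ⟨ α ≠[ e ] β ⟩ → Γ (⟨ α ⟩ ⊤')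
      c-≠ʳ  : ∀ α e β → Γ ⟨ α ≠[ e ] β ⟩ → Γ (⟨ β ⟩ ⊤')
      c-test : ∀ φ → Γ (⟨ test φ ⟩ ⊤') → Γ φ
      c-at  : ∀ i → Γ (⟨ at i ⟩ ⊤') → Γ (nom i)
      c-⨾ˡ  : ∀ α β → Γ (⟨ α ⨾ β ⟩ ⊤') → Γ (⟨ α ⟩ ⊤')
      c-⨾ʳ  : ∀ α β → Γ (⟨ α ⨾ β ⟩ ⊤') → Γ (⟨ β ⟩ ⊤')
      c-∪ˡ  : ∀ α β → Γ (⟨ α ∪ β ⟩ ⊤') → Γ (⟨ α ⟩ ⊤')
      c-∪ʳ  : ∀ α β → Γ (⟨ α ∪ β ⟩ ⊤') → Γ (⟨ β ⟩ ⊤')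

  _≡[_]_ : {𝓜 : Model} → Model.Carrier 𝓜 → FormSet → Model.Carrier 𝓜 → Set
  _≡[_]_ {𝓜} m Γ n = ∀ φ → Γ φ → (_⊨_ 𝓜 m φ ⇔ _⊨_ 𝓜 n φ)

  -- 𝓜ᶠ is a filtration of 𝓜 via Γ, where the quotient M/≡_Γ is presented
  -- by the carrier of 𝓜ᶠ together with the class map [_] = q, which is
  -- surjective and whose kernel is exactly ≡_Γ.
  record IsFiltration (𝓜 : Model) (Γ : FormSet) (𝓜ᶠ : Model)
                      (q : Model.Carrier 𝓜 → Model.Carrier 𝓜ᶠ) : Set where
    private
      module M = Model 𝓜
      module F = Model 𝓜ᶠ
    field
      q-surj   : ∀ x → ∃ (λ m → q m ≡ x)
      q-kernel : ∀ m n → (q m ≡ q n) ⇔ (_≡[_]_ {𝓜} m Γ n)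
      R-forth  : ∀ a m n → M.R a m n → F.R a (q m) (q n)
      R-back   : ∀ a m n → F.R a (q m) (q n) → Γ (⟨ act a ⟩ ⊤') →
                 ∀ m' → q m' ≡ q m → ∃ (λ n' → (q n' ≡ q n) × M.R a m' n')
      ∼-iff    : ∀ e m n → (q m F.∼[ e ] q n) ⇔ (m M.∼[ e ] n)
      nom-eq   : ∀ i → F.nomM i ≡ q (M.nomM i)
      V-eq     : ∀ m p → F.V (q m) p ⇔ M.V m p

module Submission where

-- A path of 𝓜 is carried to 𝓜ᶠ
-- because q preserves R and, inductively, the formulas in tests; conversely a
-- path of 𝓜ᶠ is lifted from any point of the source class by the back condition
-- of the filtration, which applies because closure puts ⟨a⟩⊤ into Γ for every
-- action a in a path of Γ.  Data comparisons then transfer since ∼ᶠ reflects ∼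
-- exactly on the lifted witnesses.

open import Defs
open import Data.Product using (Σ; _×_; ∃; _,_)
open import Data.Product.Function.NonDependent.Propositional using (_×-⇔_)
open import Data.Sum using (inj₁; inj₂)
open import Relation.Binary.PropositionalEquality using (_≡_; refl; sym; trans; subst; cong)
open import Function.Bundles using (_⇔_; mk⇔; Equivalence)
open import Function.Related.TypeIsomorphisms using (¬-cong-⇔)

module Filtration (S : Signature) (𝓜 : Model S) (Γ : FormSet S) (Γ-closed : Closed S Γ)
  (𝓜ᶠ : Model S) (q : Model.Carrier 𝓜 → Model.Carrier 𝓜ᶠ)
  (filtration : IsFiltration S 𝓜 Γ 𝓜ᶠ q) where
  module M = Model 𝓜
  module F = Model 𝓜ᶠ
  open Closed Γ-closed
  open IsFiltration filtration
  open Equivalence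

  _⊨M_ = _⊨_ S 𝓜
  _⊨F_ = _⊨_ S 𝓜ᶠ
  _,_⊨Mₚ_ = _,_⊨ₚ_ S 𝓜
  _,_⊨Fₚ_ = _,_⊨ₚ_ S 𝓜ᶠ

  ⟨_⟩⊤ : Path S → Form S
  ⟨ α ⟩⊤ = ⟨_⟩_ S α (⊤' S)

  ∼ᶠ-reflects : ∀ e {x y n l} → q n ≡ x → q l ≡ y → (x F.∼[ e ] y) ⇔ (n M.∼[ e ] l)
  ∼ᶠ-reflects e {n = n} {l} refl refl = ∼-iff e n l

  nomᶠ-iff : ∀ i → Γ (nom i) → ∀ m → (q m ⊨F nom i) ⇔ (m ⊨M nom i)
  nomᶠ-iff i Γi m = mk⇔ nom-reflected (λ nomM≡m → trans (nom-eq i) (cong q nomM≡m))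
    where
    nom-reflected : F.nomM i ≡ q m → M.nomM i ≡ m
    nom-reflected e = to (to (q-kernel (M.nomM i) m) (trans (sym (nom-eq i)) e) (nom i) Γi) refl

  mutual
    ⊨-filtration : ∀ φ → Γ φ → ∀ m → (q m ⊨F φ) ⇔ (m ⊨M φ)
    ⊨-filtration (prop p) Γφ m = V-eq m p
    ⊨-filtration (nom i) Γφ m = nomᶠ-iff i Γφ m
    ⊨-filtration (¬' φ) Γφ m = ¬-cong-⇔ (⊨-filtration φ (c-¬ φ Γφ) m)
    ⊨-filtration (φ ∧' ψ) Γφ m =
      ⊨-filtration φ (c-∧ˡ φ ψ Γφ) m ×-⇔ ⊨-filtration ψ (c-∧ʳ φ ψ Γφ) m
    ⊨-filtration ⟨ α =[ e ] β ⟩ Γφ m =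
      comparison-filtration α β (c-=ˡ α e β Γφ) (c-=ʳ α e β Γφ) (∼ᶠ-reflects e) m
    ⊨-filtration ⟨ α ≠[ e ] β ⟩ Γφ m =
      comparison-filtration α β (c-≠ˡ α e β Γφ) (c-≠ʳ α e β Γφ)
        (λ qn≡x ql≡y → ¬-cong-⇔ (∼ᶠ-reflects e qn≡x ql≡y)) m

    comparison-filtration : ∀ α β → Γ ⟨ α ⟩⊤ → Γ ⟨ β ⟩⊤ →
      {Pᶠ : F.Carrier → F.Carrier → Set} {P : M.Carrier → M.Carrier → Set} →
      (∀ {x y n l} → q n ≡ x → q l ≡ y → Pᶠ x y ⇔ P n l) → ∀ m →
      (Σ F.Carrier λ x → Σ F.Carrier λ y → (q m , x ⊨Fₚ α) × (q m , y ⊨Fₚ β) × Pᶠ x y)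
      ⇔ (Σ M.Carrier λ n → Σ M.Carrier λ l → (m , n ⊨Mₚ α) × (m , l ⊨Mₚ β) × P n l)
    comparison-filtration α β Γα Γβ P-reflects m = mk⇔
      (λ (x , y , αx , βy , Pxy) →
        let (n , qn≡x , αn) = ⊨ₚ-back α Γα m x αx m refl
            (l , ql≡y , βl) = ⊨ₚ-back β Γβ m y βy m refl
        in n , l , αn , βl , to (P-reflects qn≡x ql≡y) Pxy)
      (λ (n , l , αn , βl , Pnl) →
        q n , q l , ⊨ₚ-forth α Γα m n αn , ⊨ₚ-forth β Γβ m l βl ,
        from (P-reflects refl refl) Pnl)

    ⊨ₚ-forth : ∀ α → Γ ⟨ α ⟩⊤ → ∀ m n → m , n ⊨Mₚ α → q m , q n ⊨Fₚ α
    ⊨ₚ-forth (act a) Γα m n mRn = R-forth a m n mRn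
    ⊨ₚ-forth (at i) Γα m n nomM≡n = trans (nom-eq i) (cong q nomM≡n)
    ⊨ₚ-forth (test φ) Γα m n (refl , mφ) = refl , from (⊨-filtration φ (c-test φ Γα) m) mφ
    ⊨ₚ-forth (α ⨾ β) Γα m n (l , αl , βn) =
      q l , ⊨ₚ-forth α (c-⨾ˡ α β Γα) m l αl , ⊨ₚ-forth β (c-⨾ʳ α β Γα) l n βn
    ⊨ₚ-forth (α ∪ β) Γα m n (inj₁ αn) = inj₁ (⊨ₚ-forth α (c-∪ˡ α β Γα) m n αn)
    ⊨ₚ-forth (α ∪ β) Γα m n (inj₂ βn) = inj₂ (⊨ₚ-forth β (c-∪ʳ α β Γα) m n βn)

    -- Stated for an arbitrary target y of 𝓜ᶠ, since the intermediate state of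
    -- a composition is only given as a state of 𝓜ᶠ.
    ⊨ₚ-back : ∀ α → Γ ⟨ α ⟩⊤ → ∀ m y → q m , y ⊨Fₚ α →
              ∀ m' → q m' ≡ q m → ∃ λ n' → (q n' ≡ y) × m' , n' ⊨Mₚ α
    ⊨ₚ-back (act a) Γα m y qmRy m' qm'≡qm with q-surj y
    ... | n , refl = R-back a m n qmRy Γα m' qm'≡qm
    ⊨ₚ-back (at i) Γα m y nomᶠ≡y m' qm'≡qm = M.nomM i , trans (sym (nom-eq i)) nomᶠ≡y , refl
    ⊨ₚ-back (test φ) Γα m y (qm≡y , qmφ) m' qm'≡qm =
      m' , trans qm'≡qm qm≡y , refl ,
      to (⊨-filtration φ (c-test φ Γα) m') (subst (_⊨F φ) (sym qm'≡qm) qmφ)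
    ⊨ₚ-back (α ⨾ β) Γα m y (x , αx , βy) m' qm'≡qm =
      let (l' , ql'≡x , αl') = ⊨ₚ-back α (c-⨾ˡ α β Γα) m x αx m' qm'≡qm
          (n' , qn'≡y , βn') = ⊨ₚ-back β (c-⨾ʳ α β Γα) l' y
                                 (subst (λ z → z , y ⊨Fₚ β) (sym ql'≡x) βy) l' refl
      in n' , qn'≡y , l' , αl' , βn'
    ⊨ₚ-back (α ∪ β) Γα m y (inj₁ αy) m' qm'≡qm =
      let (n' , qn'≡y , αn') = ⊨ₚ-back α (c-∪ˡ α β Γα) m y αy m' qm'≡qm in n' , qn'≡y , inj₁ αn'
    ⊨ₚ-back (α ∪ β) Γα m y (inj₂ βy) m' qm'≡qm =
      let (n' , qn'≡y , βn') = ⊨ₚ-back β (c-∪ʳ α β Γα) m y βy m' qm'≡qm in n' , qn'≡y , inj₂ βn'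

  ⊨ₚ-filtration : ∀ α → Γ ⟨ α ⟩⊤ → ∀ m n →
    (q m , q n ⊨Fₚ α) ⇔ (∀ m' → q m' ≡ q m → ∃ λ n' → (q n' ≡ q n) × m' , n' ⊨Mₚ α)
  ⊨ₚ-filtration α Γα m n = mk⇔ (⊨ₚ-back α Γα m (q n)) from-m
    where
    from-m : (∀ m' → q m' ≡ q m → ∃ λ n' → (q n' ≡ q n) × m' , n' ⊨Mₚ α) → q m , q n ⊨Fₚ α
    from-m every-m' with every-m' m refl
    ... | n' , qn'≡qn , αn' = subst (λ z → q m , z ⊨Fₚ α) qn'≡qn (⊨ₚ-forth α Γα m n' αn')

theorem5p4 : (S : Signature) (𝓜 : Model S) (Γ : FormSet S) → Closed S Γ →
    (𝓜ᶠ : Model S) (q : Model.Carrier 𝓜 → Model.Carrier 𝓜ᶠ) →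
    IsFiltration S 𝓜 Γ 𝓜ᶠ q →
    ((φ : Form S) → Γ φ → (m : Model.Carrier 𝓜) →
       (_⊨_ S 𝓜ᶠ (q m) φ ⇔ _⊨_ S 𝓜 m φ))
    × ((α : Path S) → Γ (⟨_⟩_ S α (⊤' S)) → (m n : Model.Carrier 𝓜) →
       (_,_⊨ₚ_ S 𝓜ᶠ (q m) (q n) α
         ⇔ ((m' : Model.Carrier 𝓜) → q m' ≡ q m →
              ∃ (λ n' → (q n' ≡ q n) × _,_⊨ₚ_ S 𝓜 m' n' α))))
theorem5p4 S 𝓜 Γ Γ-closed 𝓜ᶠ q filtration = ⊨-filtration , ⊨ₚ-filtration
  where open Filtration S 𝓜 Γ Γ-closed 𝓜ᶠ q filtration
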